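{- Let $A$ be an $ns\times ns$ matrix whose rows and columns are indexed by $X=\{1,2,\dots,ns\}$, partitioned into blocks $A_{i,j}=A[X_i,X_j]$, $i,j=1,\dots,n$, where $X_i=\{(i-1)s+1,\dots,is\}$ (so each $A_{i,j}$ is $s\times s$). Suppose $\sum_{j=1}^n A_{i,j}=0$ for all $i$ and $\sum_{i=1}^n A_{i,j}=0$ for all $j$. Then the cofactors in $A$ of any two blocks $A_{i,j}$ and $A_{k,l}$ are equal.
   Context: For an $N\times N$ matrix $A$ and $S,K\subseteq[N]$, $A[S,K]$ is the submatrix with rows indexed by $S$ and columns indexed by $K$, and $A(S,K)$ is the matrix obtained by deleting the rows indexed by $S$ and the columns indexed by $K$. For $S=\{i_1,\dots,i_k\}$ and $K=\{j_1,\dots,j_k\}$, the cofactor of the submatrix $A[S,K]$ in $A$ is $(-1)^{i_1+\cdots+i_k+j_1+\cdots+j_k}\det A(S,K)$. The cofactor of the block $A_{i,j}$ means the cofactor of $A[X_i,X_j]$. -}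

module Defs where

open import Level using (Level)
open import Algebra.Bundles using (CommutativeRing)
open import Data.Nat.Base as ℕ using (ℕ; zero; suc)
open import Data.Fin.Base using (Fin; zero; suc; toℕ; punchIn; combine; remQuot)
open import Data.Product.Base using (proj₁; proj₂)
open import Data.List.Base as List using (allFin)
open import Data.Nat.ListAction using () renaming (sum to sumL)
open import Relation.Nullary.Decidable using (does)
open import Data.Bool.Base using (if_then_else_)

sumℕ : ∀ {s} → (Fin s → ℕ) → ℕ
sumℕ f = sumL (List.map f (allFin _))

module _ {c ℓ : Level} (R : CommutativeRing c ℓ) where
  open CommutativeRing R using (Carrier; _+_; _*_; -_; 0#; 1#)

  Σ : ∀ {n} → (Fin n → Carrier) → Carrier
  Σ {zero}  f = 0#
  Σ {suc n} f = f zero + Σ (λ i → f (suc i))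

  sgn : ℕ → Carrier
  sgn zero = 1#
  sgn (suc k) = - sgn k

  Mat : ℕ → Set c
  Mat N = Fin N → Fin N → Carrier

  det : ∀ {N} → Mat N → Carrier
  det {zero}  A = 1#
  det {suc N} A = Σ (λ j → sgn (toℕ j) * (A zero j * det (λ r c' → A (suc r) (punchIn j c'))))

  -- Block structure: X = Fin (n * s), block X_i = { combine i k | k : Fin s }
  -- (0-based: X_i = {i*s, ..., i*s + s - 1}, i.e. {(i-1)s+1,...,is} 1-based).
  -- A(X_i, X_j): delete the rows of block i and the columns of block j,
  -- keeping the remaining rows/columns in their original order.
  deleteBlocks : ∀ {m s} → Mat (suc m ℕ.* s) → Fin (suc m) → Fin (suc m) → Mat (m ℕ.* s)
  deleteBlocks {m} {s} A i j r c' =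
    A (combine (punchIn i (proj₁ (remQuot {m} s r))) (proj₂ (remQuot {m} s r)))
      (combine (punchIn j (proj₁ (remQuot {m} s c'))) (proj₂ (remQuot {m} s c')))

  -- cofactor of block A_{i,j}:
  -- (-1)^(sum of 1-based row indices in X_i + sum of 1-based column indices in X_j) * det A(X_i,X_j)
  blockCofactor : ∀ {m s} → Mat (suc m ℕ.* s) → Fin (suc m) → Fin (suc m) → Carrier
  blockCofactor {m} {s} A i j =
    sgn (sumℕ (λ (k : Fin s) → suc (toℕ (combine {suc m} i k)))
         ℕ.+ sumℕ (λ (k : Fin s) → suc (toℕ (combine {suc m} j k))))
    * det (deleteBlocks A i j)

-- Fix the deleted block row i and compare the deleted block columns j and j + 1. In
-- A(X_i, X_j) block column j + 1 stands where block column j stands in A(X_i, X_{j+1}).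
-- Since the block columns of every block row sum to zero, a column of block j + 1 is minus
-- the sum of the corresponding columns of the other blocks, and all of these except block
-- j already occur in A(X_i, X_j). So replacing one column of block j + 1 by the matching
-- column of block j only flips the sign of the determinant, and after s replacements
-- det A(X_i, X_{j+1}) = (-1)^s det A(X_i, X_j). The index sums of X_{j+1} and X_j differ
-- by s², and s² + s is even, so the two cofactors agree. Block rows are handled in the
-- same way using the column sums.

module Submission where

open import Level using (Level; _⊔_)
open import Algebra.Bundles using (CommutativeRing)
open import Data.Nat.Base as ℕ using (ℕ; zero; suc; s≤s)
import Data.Nat.Base
import Data.Nat.Properties as ℕ
open import Algebra.Properties.CommutativeSemigroup ℕ.+-commutativeSemigroup
  using () renaming (interchange to +-interchange)
open import Data.Fin.Base
  using (Fin; zero; suc; toℕ; fromℕ<; inject₁; punchIn; punchOut; combine; quotient; remainder; _<_; _≤_)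
open import Data.Fin.Properties
  using (_≟_; <-cmp; ≤∧≢⇒<; <⇒≢; suc-injective; toℕ-injective; toℕ-inject₁; toℕ-fromℕ<; toℕ<n;
         punchIn-injective; punchInᵢ≢i; punchIn-punchOut; punchOut-cong; punchOut-punchIn;
         toℕ-combine; combine-injectiveˡ; combine-remQuot; remQuot-combine)
open import Data.Fin.Induction using (<-wellFounded)
open import Induction.WellFounded using (Acc; acc)
open import Data.Product.Base using (∃-syntax; _×_; _,_; uncurry)
open import Data.Bool.Base using (if_then_else_)
open import Data.Bool.Properties using (if-eta)
open import Data.List.Base using (allFin)
open import Data.List.Properties using (map-tabulate; map-cong)
open import Data.Nat.ListAction using () renaming (sum to sumL)
open import Data.Vec.Functional using (Vector; zipWith; updateAt; replicate; transpose)
open import Data.Vec.Functional.Properties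
  using (updateAt-updates; updateAt-minimal; updateAt-commutes; updateAt-id-local)
open import Function.Base using (_∘_; id; const)
open import Function.Bundles using (mk⇔)
open import Relation.Binary.Definitions using (tri<; tri≈; tri>)
open import Relation.Binary.PropositionalEquality
  using (_≡_; _≢_; _≗_; refl; sym; trans; cong; cong₂; cong-app; subst; subst₂; module ≡-Reasoning)
open import Relation.Nullary.Decidable using (yes; no; does; dec-true; dec-false; does-⇔)
open import Relation.Nullary.Negation using (¬_; contradiction)

open import Defs

infix 4 _⋖_

data _⋖_ : ∀ {n} → Fin n → Fin n → Set where
  0⋖1 : ∀ {n} → _⋖_ {suc (suc n)} zero (suc zero)
  s⋖s : ∀ {n} {i j : Fin n} → i ⋖ j → suc i ⋖ suc j

⋖⇒toℕ : ∀ {n} {i j : Fin n} → i ⋖ j → toℕ j ≡ suc (toℕ i)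
⋖⇒toℕ 0⋖1       = refl
⋖⇒toℕ (s⋖s i⋖j) = cong suc (⋖⇒toℕ i⋖j)

⋖⇒< : ∀ {n} {i j : Fin n} → i ⋖ j → i < j
⋖⇒< i⋖j = ℕ.≤-reflexive (sym (⋖⇒toℕ i⋖j))

⋖⇒≢ : ∀ {n} {i j : Fin n} → i ⋖ j → i ≢ j
⋖⇒≢ = <⇒≢ ∘ ⋖⇒<

inject₁⋖suc : ∀ {n} (i : Fin n) → inject₁ i ⋖ suc i
inject₁⋖suc zero    = 0⋖1
inject₁⋖suc (suc i) = s⋖s (inject₁⋖suc i)

<⇒≤⋖ : ∀ {n} {i j : Fin n} → i < j → ∃[ k ] (i ≤ k × k ⋖ j)
<⇒≤⋖ {i = i} {suc j} (s≤s i≤j) =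
  inject₁ j , subst (toℕ i ℕ.≤_) (sym (toℕ-inject₁ j)) i≤j , inject₁⋖suc j

punchOut-⋖ : ∀ {n} {t i j : Fin (suc n)} (t≢i : t ≢ i) (t≢j : t ≢ j) →
             i ⋖ j → punchOut t≢i ⋖ punchOut t≢j
punchOut-⋖ {t = zero}        t≢i _   0⋖1 = contradiction refl t≢i
punchOut-⋖ {t = suc zero}    _   t≢j 0⋖1 = contradiction refl t≢j
punchOut-⋖ {suc (suc n)} {t = suc (suc t)} _ _ 0⋖1 = 0⋖1
punchOut-⋖ {t = zero}        _   _   (s⋖s i⋖j) = i⋖j
punchOut-⋖ {suc n} {t = suc t} t≢i t≢j (s⋖s i⋖j) =
  s⋖s (punchOut-⋖ (t≢i ∘ cong suc) (t≢j ∘ cong suc) i⋖j)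

⋖-punchIn-≡ : ∀ {n} {i j : Fin (suc n)} → i ⋖ j → ∀ k → punchIn i k ≢ j → punchIn i k ≡ punchIn j k
⋖-punchIn-≡ 0⋖1       zero    ne = contradiction refl ne
⋖-punchIn-≡ 0⋖1       (suc k) ne = refl
⋖-punchIn-≡ (s⋖s i⋖j) zero    ne = refl
⋖-punchIn-≡ (s⋖s i⋖j) (suc k) ne = cong suc (⋖-punchIn-≡ i⋖j k (ne ∘ cong suc))

⋖-punchIn-swap : ∀ {n} {i j : Fin (suc n)} → i ⋖ j → ∀ k → punchIn i k ≡ j → punchIn j k ≡ i
⋖-punchIn-swap 0⋖1       zero    eq = refl
⋖-punchIn-swap 0⋖1       (suc k) ()
⋖-punchIn-swap (s⋖s i⋖j) zero    ()
⋖-punchIn-swap (s⋖s i⋖j) (suc k) refl = cong suc (⋖-punchIn-swap i⋖j k refl)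

punchIn₂ : ∀ {n} {i j : Fin (suc (suc n))} → i ≢ j → Fin n → Fin (suc (suc n))
punchIn₂ {i = i} i≢j = punchIn i ∘ punchIn (punchOut i≢j)

punchIn₂-sym : ∀ {n} {i j : Fin (suc (suc n))} (i≢j : i ≢ j) (j≢i : j ≢ i) →
               punchIn₂ i≢j ≗ punchIn₂ j≢i
punchIn₂-sym {i = zero}  {zero}  i≢j _ x = contradiction refl i≢j
punchIn₂-sym {i = zero}  {suc j} _ _ x = refl
punchIn₂-sym {i = suc i} {zero}  _ _ x = refl
punchIn₂-sym {zero} {i = suc zero} {suc zero} i≢j _ x = contradiction refl i≢j
punchIn₂-sym {suc n} {i = suc i} {suc j} _ _ zero = refl
punchIn₂-sym {suc n} {i = suc i} {suc j} i≢j j≢i (suc x) =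
  cong suc (punchIn₂-sym (i≢j ∘ cong suc) (j≢i ∘ cong suc) x)

punchIn≢ : ∀ {n} {i j : Fin (suc n)} (i≢j : i ≢ j) {x : Fin n} → x ≢ punchOut i≢j → punchIn i x ≢ j
punchIn≢ {i = i} i≢j x≢ eq = x≢ (punchIn-injective i _ _ (trans eq (sym (punchIn-punchOut i≢j))))

infixl 6 _[_]≔_

_[_]≔_ : ∀ {a} {A : Set a} {n} → Vector A n → Fin n → A → Vector A n
u [ i ]≔ x = updateAt u i (const x)

≗-[]≔ : ∀ {a} {A : Set a} {n} {u w : Vector A n} {i x} →
        w i ≡ x → (∀ r → r ≢ i → w r ≡ u r) → w ≗ u [ i ]≔ x
≗-[]≔ {u = u} {i = i} wᵢ≡x w≡u r with r ≟ i
... | yes refl = trans wᵢ≡x (sym (updateAt-updates i u))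
... | no r≢i   = trans (w≡u r r≢i) (sym (updateAt-minimal r i u r≢i))

[]≔-agrees : ∀ {a} {A : Set a} {n} (u : Vector A n) {i r : Fin n} {x y : A} →
             r ≢ i → (u [ i ]≔ x) r ≡ (u [ i ]≔ y) r
[]≔-agrees u {i} {r} r≢i = trans (updateAt-minimal r i u r≢i) (sym (updateAt-minimal r i u r≢i))

module _ where
  open Data.Nat.Base using (_+_; _*_)

  sumℕ-suc : ∀ {s} (f : Fin (suc s) → ℕ) → sumℕ f ≡ f zero + sumℕ (f ∘ suc)
  sumℕ-suc f = cong (λ xs → f zero + sumL xs)
    (trans (map-tabulate suc f) (sym (map-tabulate id (f ∘ suc))))

  sumℕ-cong : ∀ {s} {f g : Fin s → ℕ} → f ≗ g → sumℕ f ≡ sumℕ g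
  sumℕ-cong f≗g = cong sumL (map-cong f≗g (allFin _))

  sumℕ-+ˡ : ∀ {s} d (f : Fin s → ℕ) → sumℕ (λ k → d + f k) ≡ s * d + sumℕ f
  sumℕ-+ˡ {zero}  d f = refl
  sumℕ-+ˡ {suc s} d f = begin
    sumℕ (λ k → d + f k)                     ≡⟨ sumℕ-suc (λ k → d + f k) ⟩
    (d + f zero) + sumℕ (λ k → d + f (suc k)) ≡⟨ cong (d + f zero +_) (sumℕ-+ˡ d (f ∘ suc)) ⟩
    (d + f zero) + (s * d + sumℕ (f ∘ suc))   ≡⟨ +-interchange d (f zero) (s * d) _ ⟩
    (d + s * d) + (f zero + sumℕ (f ∘ suc))   ≡⟨ cong (d + s * d +_) (sym (sumℕ-suc f)) ⟩
    suc s * d + sumℕ f                        ∎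
    where open ≡-Reasoning

  blockIndexSum : ∀ {m} s → Fin m → ℕ
  blockIndexSum s i = sumℕ (λ (k : Fin s) → suc (toℕ (combine i k)))

  blockIndexSum-⋖ : ∀ {m} s {i j : Fin m} → i ⋖ j → blockIndexSum s j ≡ s * s + blockIndexSum s i
  blockIndexSum-⋖ s {i} {j} i⋖j =
    trans (sumℕ-cong shift) (sumℕ-+ˡ s (λ (k : Fin s) → suc (toℕ (combine i k))))
    where
    open ≡-Reasoning
    shift : ∀ (k : Fin s) → suc (toℕ (combine j k)) ≡ s + suc (toℕ (combine i k))
    shift k = begin
      suc (toℕ (combine j k))             ≡⟨ cong suc (toℕ-combine j k) ⟩
      suc (s * toℕ j + toℕ k)             ≡⟨ cong (λ x → suc (s * x + toℕ k)) (⋖⇒toℕ i⋖j) ⟩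
      suc (s * suc (toℕ i) + toℕ k)       ≡⟨ cong (λ x → suc (x + toℕ k)) (ℕ.*-suc s (toℕ i)) ⟩
      suc (s + s * toℕ i + toℕ k)         ≡⟨ cong suc (ℕ.+-assoc s _ _) ⟩
      suc (s + (s * toℕ i + toℕ k))       ≡⟨ ℕ.+-suc s _ ⟨
      s + suc (s * toℕ i + toℕ k)         ≡⟨ cong (λ x → s + suc x) (toℕ-combine i k) ⟨
      s + suc (toℕ (combine i k))         ∎

module _ {c ℓ : Level} (R : CommutativeRing c ℓ) where

  open CommutativeRing R hiding (zero) renaming (refl to ≈-refl; sym to ≈-sym; trans to ≈-trans)
  open import Algebra.Properties.Ring ring
    using (-‿involutive; -‿distribˡ-*; -‿distribʳ-*; -0#≈0#; x+x≈x⇒x≈0;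
           +-inverseˡ-unique; +-inverseʳ-unique)
  open import Algebra.Properties.Semiring.Sum semiring
    using (sum; sum-syntax; sum-cong-≋; ∑-distrib-+; *-distribˡ-sum; sum-remove; sum-replicate-zero)
  open import Algebra.Properties.CommutativeSemigroup *-commutativeSemigroup
    using (x∙yz≈y∙xz; interchange)
  open import Data.Vec.Functional.Relation.Binary.Equality.Setoid setoid
    using (_≋_; ≋-sym; ≋-trans; ≋-reflexive)
  open import Relation.Binary.Reasoning.Setoid setoid

  Σ≡sum : ∀ {n} (f : Fin n → Carrier) → Σ R f ≡ sum f
  Σ≡sum {zero}  f = refl
  Σ≡sum {suc n} f = cong (f zero +_) (Σ≡sum (f ∘ suc))

  sum-zero : ∀ {n} {f : Fin n → Carrier} → (∀ i → f i ≈ 0#) → sum f ≈ 0#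
  sum-zero {n} f≈0 = ≈-trans (sum-cong-≋ f≈0) (sum-replicate-zero n)

  sum-pair : ∀ {n} {f : Fin n → Carrier} {a b : Fin n} → a ≢ b →
             (∀ t → t ≢ a → t ≢ b → f t ≈ 0#) → sum f ≈ f a + f b
  sum-pair {suc zero}    {a = zero} {zero} a≢b _ = contradiction refl a≢b
  sum-pair {suc (suc n)} {f} {a} {b} a≢b f≈0 = begin
    sum f                                           ≈⟨ sum-remove f ⟩
    f a + sum (f ∘ punchIn a)                       ≈⟨ +-congˡ (sum-remove (f ∘ punchIn a)) ⟩
    f a + (f (punchIn a k) + sum (f ∘ punchIn a ∘ punchIn k))
      ≈⟨ +-congˡ (+-cong (reflexive (cong f (punchIn-punchOut a≢b))) (sum-zero rest≈0)) ⟩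
    f a + (f b + 0#)                                ≈⟨ +-congˡ (+-identityʳ (f b)) ⟩
    f a + f b                                       ∎
    where
    k : Fin (suc n)
    k = punchOut a≢b
    rest≈0 : ∀ x → f (punchIn a (punchIn k x)) ≈ 0#
    rest≈0 x = f≈0 _ (punchInᵢ≢i a _) (punchIn≢ a≢b (punchInᵢ≢i k x))

  ∑∑-alternating≈0 : ∀ {n} (Y : Fin n → Fin n → Carrier) → (∀ j → Y j j ≈ 0#) →
                     (∀ {j k} → j ≢ k → Y j k ≈ - Y k j) → ∑[ j < n ] ∑[ k < n ] Y j k ≈ 0#
  ∑∑-alternating≈0 {zero}  Y _    _    = ≈-refl
  ∑∑-alternating≈0 {suc n} Y diag anti = begin
    (Y zero zero + S₀) + ∑[ j < n ] (Y (suc j) zero + ∑[ k < n ] Y (suc j) (suc k))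
      ≈⟨ +-congˡ (∑-distrib-+ (λ j → Y (suc j) zero) _) ⟩
    (Y zero zero + S₀) + (S₁ + S)   ≈⟨ +-assoc _ _ _ ⟩
    Y zero zero + (S₀ + (S₁ + S))   ≈⟨ +-congˡ (+-assoc _ _ _) ⟨
    Y zero zero + ((S₀ + S₁) + S)
      ≈⟨ +-cong (diag zero) (+-cong mixed≈0 (∑∑-alternating≈0 (λ j k → Y (suc j) (suc k))
                                               (diag ∘ suc) (λ j≢k → anti (j≢k ∘ suc-injective)))) ⟩
    0# + (0# + 0#)                  ≈⟨ +-identityˡ _ ⟩
    0# + 0#                         ≈⟨ +-identityˡ _ ⟩
    0#                              ∎
    where
    S₀ S₁ S : Carrier
    S₀ = ∑[ k < n ] Y zero (suc k)
    S₁ = ∑[ j < n ] Y (suc j) zero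
    S  = ∑[ j < n ] ∑[ k < n ] Y (suc j) (suc k)
    mixed≈0 : S₀ + S₁ ≈ 0#
    mixed≈0 = ≈-trans (≈-sym (∑-distrib-+ (λ k → Y zero (suc k)) _))
                      (sum-zero λ k → ≈-trans (+-congʳ (anti {zero} {suc k} λ ())) (-‿inverseˡ _))

  -x*-y≈x*y : ∀ x y → - x * - y ≈ x * y
  -x*-y≈x*y x y = begin
    - x * - y     ≈⟨ -‿distribʳ-* (- x) y ⟨
    - (- x * y)   ≈⟨ -‿cong (-‿distribˡ-* x y) ⟨
    - - (x * y)   ≈⟨ -‿involutive _ ⟩
    x * y         ∎

  sgn-+ : ∀ m n → sgn R (m ℕ.+ n) ≈ sgn R m * sgn R n
  sgn-+ zero    n = ≈-sym (*-identityˡ _)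
  sgn-+ (suc m) n = ≈-trans (-‿cong (sgn-+ m n)) (-‿distribˡ-* _ _)

  sgn*sgn≈1 : ∀ n → sgn R n * sgn R n ≈ 1#
  sgn*sgn≈1 zero    = *-identityˡ 1#
  sgn*sgn≈1 (suc n) = ≈-trans (-x*-y≈x*y _ _) (sgn*sgn≈1 n)

  sgn-square : ∀ n → sgn R (n ℕ.* n) ≈ sgn R n
  sgn-square zero    = ≈-refl
  sgn-square (suc n) = -‿cong (begin
    sgn R (n ℕ.+ n ℕ.* suc n)                    ≡⟨ cong (λ x → sgn R (n ℕ.+ x)) (ℕ.*-suc n n) ⟩
    sgn R (n ℕ.+ (n ℕ.+ n ℕ.* n))                ≈⟨ ≈-trans (sgn-+ n _) (*-congˡ (sgn-+ n _)) ⟩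
    sgn R n * (sgn R n * sgn R (n ℕ.* n))        ≈⟨ *-assoc _ _ _ ⟨
    (sgn R n * sgn R n) * sgn R (n ℕ.* n)        ≈⟨ *-congʳ (sgn*sgn≈1 n) ⟩
    1# * sgn R (n ℕ.* n)                         ≈⟨ *-identityˡ _ ⟩
    sgn R (n ℕ.* n)                              ≈⟨ sgn-square n ⟩
    sgn R n                                      ∎)

  sgn-punchOut-antisym : ∀ {n} {i j : Fin (suc n)} (i≢j : i ≢ j) (j≢i : j ≢ i) →
    sgn R (toℕ i) * sgn R (toℕ (punchOut i≢j)) ≈ - (sgn R (toℕ j) * sgn R (toℕ (punchOut j≢i)))
  sgn-punchOut-antisym {i = zero} {zero} i≢j _ = contradiction refl i≢j
  sgn-punchOut-antisym {suc n} {zero} {suc j} _ _ = begin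
    1# * sgn R (toℕ j)           ≈⟨ *-identityˡ _ ⟩
    sgn R (toℕ j)                ≈⟨ -‿involutive _ ⟨
    - - sgn R (toℕ j)            ≈⟨ -‿cong (*-identityʳ _) ⟨
    - (- sgn R (toℕ j) * 1#)     ∎
  sgn-punchOut-antisym {suc n} {suc i} {zero} _ _ = begin
    - sgn R (toℕ i) * 1#         ≈⟨ *-identityʳ _ ⟩
    - sgn R (toℕ i)              ≈⟨ -‿cong (*-identityˡ _) ⟨
    - (1# * sgn R (toℕ i))       ∎
  sgn-punchOut-antisym {suc n} {suc i} {suc j} i≢j j≢i =
    ≈-trans (-x*-y≈x*y _ _)
      (≈-trans (sgn-punchOut-antisym (i≢j ∘ cong suc) (j≢i ∘ cong suc)) (-‿cong (≈-sym (-x*-y≈x*y _ _))))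

  -- Laplace expansion

  minor : ∀ {N} → Mat R (suc N) → Fin (suc N) → Mat R N
  minor A j r = A (suc r) ∘ punchIn j

  laplaceTerm : ∀ {N} → Mat R (suc N) → Fin (suc N) → Carrier
  laplaceTerm A j = sgn R (toℕ j) * (A zero j * det R (minor A j))

  det-laplace : ∀ {N} (A : Mat R (suc N)) → det R A ≈ sum (laplaceTerm A)
  det-laplace A = reflexive (Σ≡sum (laplaceTerm A))

  det-cong : ∀ {N} {A B : Mat R N} → (∀ r → A r ≋ B r) → det R A ≈ det R B
  det-cong {zero}          _   = ≈-refl
  det-cong {suc N} {A} {B} A≋B = begin
    det R A              ≈⟨ det-laplace A ⟩
    sum (laplaceTerm A)  ≈⟨ sum-cong-≋ (λ j → *-congˡ {sgn R (toℕ j)}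
                              (*-cong (A≋B zero j) (det-cong (λ r → A≋B (suc r) ∘ punchIn j)))) ⟩
    sum (laplaceTerm B)  ≈⟨ det-laplace B ⟨
    det R B              ∎

  laplaceTerm≈0 : ∀ {N} (A : Mat R (suc N)) j → det R (minor A j) ≈ 0# → laplaceTerm A j ≈ 0#
  laplaceTerm≈0 A j minor≈0 =
    ≈-trans (*-congˡ (≈-trans (*-congˡ minor≈0) (zeroʳ (A zero j)))) (zeroʳ (sgn R (toℕ j)))

  det≈0-by-minors : ∀ {N} (A : Mat R (suc N)) → (∀ j → det R (minor A j) ≈ 0#) → det R A ≈ 0#
  det≈0-by-minors A minors≈0 = ≈-trans (det-laplace A) (sum-zero λ j → laplaceTerm≈0 A j (minors≈0 j))

  det-additive-by-terms : ∀ {N} (A B C : Mat R (suc N)) →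
    (∀ j → laplaceTerm C j ≈ laplaceTerm A j + laplaceTerm B j) → det R C ≈ det R A + det R B
  det-additive-by-terms A B C C≈A+B = begin
    det R C                                      ≈⟨ det-laplace C ⟩
    sum (laplaceTerm C)                          ≈⟨ sum-cong-≋ C≈A+B ⟩
    ∑[ j < _ ] (laplaceTerm A j + laplaceTerm B j) ≈⟨ ∑-distrib-+ (laplaceTerm A) (laplaceTerm B) ⟩
    sum (laplaceTerm A) + sum (laplaceTerm B)    ≈⟨ +-cong (det-laplace A) (det-laplace B) ⟨
    det R A + det R B                            ∎

  laplaceTerm-additive-entry : ∀ {N} {A B C : Mat R (suc N)} {j} → C zero j ≈ A zero j + B zero j →
    det R (minor C j) ≈ det R (minor A j) → det R (minor C j) ≈ det R (minor B j) →
    laplaceTerm C j ≈ laplaceTerm A j + laplaceTerm B j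
  laplaceTerm-additive-entry C≈A+B C≈A C≈B = ≈-trans
    (*-congˡ (≈-trans (*-congʳ C≈A+B) (distribʳ _ _ _)))
    (≈-trans (distribˡ _ _ _) (+-cong (*-congˡ (*-congˡ C≈A)) (*-congˡ (*-congˡ C≈B))))

  laplaceTerm-additive-minor : ∀ {N} {A B C : Mat R (suc N)} {j} → C zero j ≈ A zero j → C zero j ≈ B zero j →
    det R (minor C j) ≈ det R (minor A j) + det R (minor B j) →
    laplaceTerm C j ≈ laplaceTerm A j + laplaceTerm B j
  laplaceTerm-additive-minor C≈A C≈B C≈A+B = ≈-trans
    (*-congˡ (≈-trans (*-congˡ C≈A+B) (distribˡ _ _ _)))
    (≈-trans (distribˡ _ _ _) (+-cong (*-congˡ (*-congʳ C≈A)) (*-congˡ (*-congʳ C≈B))))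

  det-additive-row : ∀ {N} (i : Fin N) {A B C : Mat R N} →
    (∀ r → r ≢ i → C r ≋ A r) → (∀ r → r ≢ i → C r ≋ B r) → C i ≋ zipWith _+_ (A i) (B i) →
    det R C ≈ det R A + det R B
  det-additive-row zero {A} {B} {C} C≋A C≋B Cᵢ≋Aᵢ+Bᵢ = det-additive-by-terms A B C λ j →
    laplaceTerm-additive-entry {A = A} {B} {C} (Cᵢ≋Aᵢ+Bᵢ j)
      (det-cong λ r → C≋A (suc r) (λ ()) ∘ punchIn j) (det-cong λ r → C≋B (suc r) (λ ()) ∘ punchIn j)
  det-additive-row (suc i) {A} {B} {C} C≋A C≋B Cᵢ≋Aᵢ+Bᵢ = det-additive-by-terms A B C λ j →
    laplaceTerm-additive-minor {A = A} {B} {C} (C≋A zero (λ ()) j) (C≋B zero (λ ()) j)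
      (det-additive-row i (λ r r≢i → C≋A (suc r) (r≢i ∘ suc-injective) ∘ punchIn j)
                          (λ r r≢i → C≋B (suc r) (r≢i ∘ suc-injective) ∘ punchIn j)
                          (Cᵢ≋Aᵢ+Bᵢ ∘ punchIn j))

  det-additive-col : ∀ {N} (i : Fin N) {A B C : Mat R N} →
    (∀ r x → x ≢ i → C r x ≈ A r x) → (∀ r x → x ≢ i → C r x ≈ B r x) →
    (∀ r → C r i ≈ A r i + B r i) →
    det R C ≈ det R A + det R B
  det-additive-col {suc N} i {A} {B} {C} C≈A C≈B Cᵢ≈Aᵢ+Bᵢ = det-additive-by-terms A B C term
    where
    term : ∀ j → laplaceTerm C j ≈ laplaceTerm A j + laplaceTerm B j
    term j with j ≟ i
    ... | yes refl = laplaceTerm-additive-entry {A = A} {B} {C} (Cᵢ≈Aᵢ+Bᵢ zero)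
      (det-cong λ r x → C≈A (suc r) _ (punchInᵢ≢i j x)) (det-cong λ r x → C≈B (suc r) _ (punchInᵢ≢i j x))
    ... | no j≢i = laplaceTerm-additive-minor {A = A} {B} {C} (C≈A zero j j≢i) (C≈B zero j j≢i)
      (det-additive-col (punchOut j≢i) (λ r x x≢ → C≈A (suc r) _ (punchIn≢ j≢i x≢))
                                       (λ r x x≢ → C≈B (suc r) _ (punchIn≢ j≢i x≢))
                                       (λ r → subst (λ x → C (suc r) x ≈ A (suc r) x + B (suc r) x)
                                                    (sym (punchIn-punchOut j≢i)) (Cᵢ≈Aᵢ+Bᵢ (suc r))))

  module _ {N} (A : Mat R (suc (suc N))) (A₀≋A₁ : A zero ≋ A (suc zero)) where

    private
      a : Fin (suc (suc N)) → Carrier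
      a = A zero

    sgn₂ : ∀ {j k : Fin (suc (suc N))} → j ≢ k → Carrier
    sgn₂ {j} j≢k = sgn R (toℕ j) * sgn R (toℕ (punchOut j≢k))

    doubleMinor : ∀ {j k : Fin (suc (suc N))} → j ≢ k → Mat R N
    doubleMinor j≢k r = A (suc (suc r)) ∘ punchIn₂ j≢k

    -- Term (j, k) of the expansion along rows 0 and 1, using the entries in columns j and k.
    twoRowTerm : Fin (suc (suc N)) → Fin (suc (suc N)) → Carrier
    twoRowTerm j k with j ≟ k
    ... | yes _  = 0#
    ... | no j≢k = sgn₂ j≢k * (a j * (a k * det R (doubleMinor j≢k)))

    twoRowTerm-diag : ∀ j → twoRowTerm j j ≈ 0#
    twoRowTerm-diag j with j ≟ j
    ... | yes _  = ≈-refl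
    ... | no j≢j = contradiction refl j≢j

    twoRowTerm-antisym : ∀ {j k} → j ≢ k → twoRowTerm j k ≈ - twoRowTerm k j
    twoRowTerm-antisym {j} {k} j≢k with j ≟ k | k ≟ j
    ... | yes j≡k | _       = contradiction j≡k j≢k
    ... | no _    | yes k≡j = contradiction (sym k≡j) j≢k
    ... | no j≢k  | no k≢j  = begin
      sgn₂ j≢k * (a j * (a k * det R (doubleMinor j≢k)))
        ≈⟨ *-cong (sgn-punchOut-antisym j≢k k≢j)
                  (≈-trans (x∙yz≈y∙xz _ _ _) (*-congˡ (*-congˡ (det-cong λ r x →
                     reflexive (cong (A (suc (suc r))) (punchIn₂-sym j≢k k≢j x)))))) ⟩
      - sgn₂ k≢j * (a k * (a j * det R (doubleMinor k≢j)))   ≈⟨ -‿distribˡ-* _ _ ⟨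
      - (sgn₂ k≢j * (a k * (a j * det R (doubleMinor k≢j)))) ∎

    twoRowTerm-punchIn : ∀ j k → twoRowTerm j (punchIn j k) ≈
      (sgn R (toℕ j) * sgn R (toℕ k)) * (a j * (a (punchIn j k) * det R (minor (minor A j) k)))
    twoRowTerm-punchIn j k with j ≟ punchIn j k
    ... | yes j≡jₖ = contradiction (sym j≡jₖ) (punchInᵢ≢i j k)
    ... | no j≢jₖ  = reflexive (cong (λ k′ → (sgn R (toℕ j) * sgn R (toℕ k′)) * (a j * (a (punchIn j k)
                                             * det R (λ r → A (suc (suc r)) ∘ punchIn j ∘ punchIn k′))))
                                      (trans (punchOut-cong j refl) (punchOut-punchIn j)))

    laplaceTerm≈∑twoRowTerm : ∀ j → laplaceTerm A j ≈ ∑[ k < suc (suc N) ] twoRowTerm j k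
    laplaceTerm≈∑twoRowTerm j = begin
      sgn R (toℕ j) * (a j * det R (minor A j))
        ≈⟨ *-congˡ (*-congˡ (det-laplace (minor A j))) ⟩
      sgn R (toℕ j) * (a j * sum (laplaceTerm (minor A j)))
        ≈⟨ ≈-trans (*-congˡ (*-distribˡ-sum (a j) (laplaceTerm (minor A j))))
                   (*-distribˡ-sum (sgn R (toℕ j)) (λ k → a j * laplaceTerm (minor A j) k)) ⟩
      ∑[ k < suc N ] (sgn R (toℕ j) * (a j * laplaceTerm (minor A j) k))
        ≈⟨ sum-cong-≋ (λ k → ≈-trans (regroup _ _ _ _ (≈-sym (A₀≋A₁ (punchIn j k))))
                                     (≈-sym (twoRowTerm-punchIn j k))) ⟩
      ∑[ k < suc N ] twoRowTerm j (punchIn j k)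
        ≈⟨ ≈-trans (+-congʳ (twoRowTerm-diag j)) (+-identityˡ _) ⟨
      twoRowTerm j j + ∑[ k < suc N ] twoRowTerm j (punchIn j k)
        ≈⟨ sum-remove (twoRowTerm j) ⟨
      ∑[ k < suc (suc N) ] twoRowTerm j k ∎
      where
      regroup : ∀ s x t {y y′} d → y ≈ y′ → s * (x * (t * (y * d))) ≈ (s * t) * (x * (y′ * d))
      regroup s x t {y} d y≈y′ = ≈-trans (*-congˡ (x∙yz≈y∙xz x t (y * d)))
                                         (≈-trans (≈-sym (*-assoc s t _)) (*-congˡ (*-congˡ (*-congʳ y≈y′))))

    det-equal-top-rows : det R A ≈ 0#
    det-equal-top-rows = begin
      det R A                                                     ≈⟨ det-laplace A ⟩
      sum (laplaceTerm A)                                         ≈⟨ sum-cong-≋ laplaceTerm≈∑twoRowTerm ⟩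
      ∑[ j < suc (suc N) ] ∑[ k < suc (suc N) ] twoRowTerm j k
        ≈⟨ ∑∑-alternating≈0 twoRowTerm twoRowTerm-diag twoRowTerm-antisym ⟩
      0#                                                          ∎

  det-⋖-rows : ∀ {N} {A : Mat R N} {i j} → i ⋖ j → A i ≋ A j → det R A ≈ 0#
  det-⋖-rows {A = A} 0⋖1       Aᵢ≋Aⱼ = det-equal-top-rows A Aᵢ≋Aⱼ
  det-⋖-rows {A = A} (s⋖s i⋖j) Aᵢ≋Aⱼ = det≈0-by-minors A λ k → det-⋖-rows i⋖j (Aᵢ≋Aⱼ ∘ punchIn k)

  det-⋖-cols : ∀ {N} {A : Mat R N} {i j} → i ⋖ j → (∀ r → A r i ≈ A r j) → det R A ≈ 0#
  det-⋖-cols {suc N} {A} {i} {j} i⋖j Aᵢ≈Aⱼ = begin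
    det R A                             ≈⟨ det-laplace A ⟩
    sum (laplaceTerm A)                 ≈⟨ sum-pair (⋖⇒≢ i⋖j) others≈0 ⟩
    laplaceTerm A i + laplaceTerm A j   ≈⟨ +-congʳ (*-congˡ (*-cong (Aᵢ≈Aⱼ zero) (det-cong minors≋))) ⟩
    sgn R (toℕ i) * y + laplaceTerm A j ≡⟨ cong (λ n → sgn R (toℕ i) * y + sgn R n * y) (⋖⇒toℕ i⋖j) ⟩
    sgn R (toℕ i) * y + - sgn R (toℕ i) * y ≈⟨ +-congˡ (-‿distribˡ-* _ _) ⟨
    sgn R (toℕ i) * y + - (sgn R (toℕ i) * y) ≈⟨ -‿inverseʳ _ ⟩
    0#                                  ∎
    where
    y : Carrier
    y = A zero j * det R (minor A j)
    others≈0 : ∀ t → t ≢ i → t ≢ j → laplaceTerm A t ≈ 0#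
    others≈0 t t≢i t≢j = laplaceTerm≈0 A t (det-⋖-cols (punchOut-⋖ t≢i t≢j i⋖j) λ r →
      subst₂ (λ x x′ → A (suc r) x ≈ A (suc r) x′)
             (sym (punchIn-punchOut t≢i)) (sym (punchIn-punchOut t≢j)) (Aᵢ≈Aⱼ (suc r)))
    minors≋ : ∀ r → minor A i r ≋ minor A j r
    minors≋ r k with punchIn i k ≟ j
    ... | yes iₖ≡j = begin
      A (suc r) (punchIn i k)  ≡⟨ cong (A (suc r)) iₖ≡j ⟩
      A (suc r) j              ≈⟨ Aᵢ≈Aⱼ (suc r) ⟨
      A (suc r) i              ≡⟨ cong (A (suc r)) (⋖-punchIn-swap i⋖j k iₖ≡j) ⟨
      A (suc r) (punchIn j k)  ∎
    ... | no iₖ≢j  = reflexive (cong (A (suc r)) (⋖-punchIn-≡ i⋖j k iₖ≢j))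

  -- Alternating multilinear functions of rows

  Rows : ℕ → ℕ → Set c
  Rows N K = Fin N → Vector Carrier K

  []≔-cong : ∀ {N K} (u : Rows N K) i {x y} → x ≋ y → ∀ r → (u [ i ]≔ x) r ≋ (u [ i ]≔ y) r
  []≔-cong u i x≋y r with r ≟ i
  ... | yes refl = subst₂ _≋_ (sym (updateAt-updates i u)) (sym (updateAt-updates i u)) x≋y
  ... | no r≢i   = ≋-reflexive ([]≔-agrees u r≢i)

  []≔-zipWith : ∀ {N K} (u : Rows N K) i x y →
                (u [ i ]≔ zipWith _+_ x y) i ≋ zipWith _+_ ((u [ i ]≔ x) i) ((u [ i ]≔ y) i)
  []≔-zipWith u i x y = ≋-reflexive (trans (updateAt-updates i u)
    (sym (cong₂ (zipWith _+_) (updateAt-updates i u) (updateAt-updates i u))))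

  record IsAlternatingMultilinear {N K} (F : Rows N K → Carrier) : Set (c ⊔ ℓ) where
    field
      rows-cong   : ∀ {u v} → (∀ r → u r ≋ v r) → F u ≈ F v
      additive    : ∀ u i x y → F (u [ i ]≔ zipWith _+_ x y) ≈ F (u [ i ]≔ x) + F (u [ i ]≔ y)
      alternating : ∀ {u i j} → i ≢ j → u i ≋ u j → F u ≈ 0#

    rows-cong-≗ : ∀ {u v} → u ≗ v → F u ≈ F v
    rows-cong-≗ u≗v = rows-cong (≋-reflexive ∘ u≗v)

    zero-row : ∀ u i → F (u [ i ]≔ replicate K 0#) ≈ 0#
    zero-row u i = x+x≈x⇒x≈0 _
      (≈-trans (≈-sym (additive u i _ _)) (rows-cong ([]≔-cong u i (λ _ → +-identityˡ 0#))))

    sum-row : ∀ {n} u i (x : Fin n → Vector Carrier K) →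
              F (u [ i ]≔ (λ y → ∑[ t < n ] x t y)) ≈ ∑[ t < n ] F (u [ i ]≔ x t)
    sum-row {zero}  u i x = zero-row u i
    sum-row {suc n} u i x = ≈-trans (additive u i (x zero) _) (+-congˡ (sum-row u i (x ∘ suc)))

    zero-sum-exchange : ∀ {n} u i (x : Fin n → Vector Carrier K) {a b} → a ≢ b →
      (∀ y → ∑[ t < n ] x t y ≈ 0#) → (∀ t → t ≢ a → t ≢ b → ∃[ r ] (r ≢ i × u r ≋ x t)) →
      F (u [ i ]≔ x a) ≈ - F (u [ i ]≔ x b)
    zero-sum-exchange {n} u i x {a} {b} a≢b ∑x≈0 x-elsewhere = +-inverseˡ-unique _ _ (begin
      F (u [ i ]≔ x a) + F (u [ i ]≔ x b)    ≈⟨ sum-pair a≢b others≈0 ⟨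
      ∑[ t < n ] F (u [ i ]≔ x t)            ≈⟨ sum-row u i x ⟨
      F (u [ i ]≔ (λ y → ∑[ t < n ] x t y))  ≈⟨ rows-cong ([]≔-cong u i ∑x≈0) ⟩
      F (u [ i ]≔ replicate K 0#)            ≈⟨ zero-row u i ⟩
      0#                                     ∎)
      where
      others≈0 : ∀ t → t ≢ a → t ≢ b → F (u [ i ]≔ x t) ≈ 0#
      others≈0 t t≢a t≢b with x-elsewhere t t≢a t≢b
      ... | r , r≢i , uᵣ≋xₜ = alternating (r≢i ∘ sym) (≋-trans (≋-reflexive (updateAt-updates i u))
                                (≋-trans (≋-sym uᵣ≋xₜ) (≋-reflexive (sym (updateAt-minimal r i u r≢i)))))

  module FromAdjacent {N K} {F : Rows N K → Carrier}
    (rows-cong : ∀ {u v} → (∀ r → u r ≋ v r) → F u ≈ F v)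
    (additive  : ∀ u i x y → F (u [ i ]≔ zipWith _+_ x y) ≈ F (u [ i ]≔ x) + F (u [ i ]≔ y))
    (adjacent  : ∀ {u i j} → i ⋖ j → u i ≋ u j → F u ≈ 0#)
    where

    -- Polarisation: expand the family with both rows i and j equal to uᵢ + uⱼ.
    swap-negates : ∀ {u i j} → i ≢ j → (∀ {w} → w i ≋ w j → F w ≈ 0#) →
                   F ((u [ i ]≔ u j) [ j ]≔ u i) ≈ - F u
    swap-negates {u} {i} {j} i≢j vanishes = +-inverseʳ-unique _ _ (begin
      F u + F (W (u j) (u i))
        ≈⟨ +-cong (≈-trans (rows-cong (≋-reflexive ∘ sym ∘ W-self)) (≈-sym (+-identityˡ _)))
                  (≈-sym (+-identityʳ _)) ⟩
      (0# + F (W (u i) (u j))) + (F (W (u j) (u i)) + 0#)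
        ≈⟨ +-cong (+-congʳ (W-diag (u i))) (+-congˡ (W-diag (u j))) ⟨
      (F (W (u i) (u i)) + F (W (u i) (u j))) + (F (W (u j) (u i)) + F (W (u j) (u j)))
        ≈⟨ +-cong (additiveⱼ (u i) _ _) (additiveⱼ (u j) _ _) ⟨
      F (W (u i) s) + F (W (u j) s)  ≈⟨ additiveᵢ _ _ s ⟨
      F (W s s)                      ≈⟨ W-diag s ⟩
      0#                             ∎)
      where
      W : Vector Carrier K → Vector Carrier K → Rows N K
      W x y = (u [ i ]≔ x) [ j ]≔ y
      s : Vector Carrier K
      s = zipWith _+_ (u i) (u j)
      W-diag : ∀ x → F (W x x) ≈ 0#
      W-diag x = vanishes (≋-reflexive (trans (updateAt-minimal i j _ i≢j)
                                             (trans (updateAt-updates i u) (sym (updateAt-updates j _)))))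
      W-self : W (u i) (u j) ≗ u
      W-self r = trans (updateAt-id-local j (u [ i ]≔ u i) (sym (updateAt-id-local i u refl j)) r)
                       (updateAt-id-local i u refl r)
      additiveⱼ : ∀ x y z → F (W x (zipWith _+_ y z)) ≈ F (W x y) + F (W x z)
      additiveⱼ x = additive (u [ i ]≔ x) j
      additiveᵢ : ∀ x y z → F (W (zipWith _+_ x y) z) ≈ F (W x z) + F (W y z)
      additiveᵢ x y z = begin
        F (W (zipWith _+_ x y) z)                        ≈⟨ commute ⟩
        F ((u [ j ]≔ z) [ i ]≔ zipWith _+_ x y)          ≈⟨ additive (u [ j ]≔ z) i x y ⟩
        F ((u [ j ]≔ z) [ i ]≔ x) + F ((u [ j ]≔ z) [ i ]≔ y) ≈⟨ +-cong commute commute ⟨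
        F (W x z) + F (W y z)                            ∎
        where
        commute : ∀ {x} → F (W x z) ≈ F ((u [ j ]≔ z) [ i ]≔ x)
        commute = rows-cong (≋-reflexive ∘ updateAt-commutes j i (i≢j ∘ sym) u)

    vanish-below : ∀ {j} → Acc _<_ j → ∀ {u i} → i < j → u i ≋ u j → F u ≈ 0#
    vanish-below {j} (acc below) {u} {i} i<j uᵢ≋uⱼ with <⇒≤⋖ i<j
    ... | k , i≤k , k⋖j with i ≟ k
    ...   | yes refl = adjacent k⋖j uᵢ≋uⱼ
    ...   | no i≢k   = begin
      F u          ≈⟨ -‿involutive _ ⟨
      - - F u      ≈⟨ -‿cong (swap-negates (⋖⇒≢ k⋖j) (adjacent k⋖j)) ⟨
      - F u′       ≈⟨ -‿cong (vanish-below (below (⋖⇒< k⋖j)) (≤∧≢⇒< i≤k i≢k) u′ᵢ≋u′ₖ) ⟩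
      - 0#         ≈⟨ -0#≈0# ⟩
      0#           ∎
      where
      u′ : Rows N K
      u′ = (u [ k ]≔ u j) [ j ]≔ u k
      u′ᵢ≋u′ₖ : u′ i ≋ u′ k
      u′ᵢ≋u′ₖ = ≋-trans (≋-reflexive (trans (updateAt-minimal i j _ (<⇒≢ i<j)) (updateAt-minimal i k u i≢k)))
                (≋-trans uᵢ≋uⱼ
                  (≋-reflexive (sym (trans (updateAt-minimal k j _ (⋖⇒≢ k⋖j)) (updateAt-updates k u)))))

    alternating : ∀ {u i j} → i ≢ j → u i ≋ u j → F u ≈ 0#
    alternating {u} {i} {j} i≢j uᵢ≋uⱼ with <-cmp i j
    ... | tri< i<j _ _ = vanish-below (<-wellFounded j) i<j uᵢ≋uⱼ
    ... | tri≈ _ i≡j _ = contradiction i≡j i≢j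
    ... | tri> _ _ j<i = vanish-below (<-wellFounded i) j<i (≋-sym uᵢ≋uⱼ)

    isAlternatingMultilinear : IsAlternatingMultilinear F
    isAlternatingMultilinear = record { rows-cong = rows-cong ; additive = additive ; alternating = alternating }

  det-isAlternatingMultilinear : ∀ {N} → IsAlternatingMultilinear (det R {N})
  det-isAlternatingMultilinear = FromAdjacent.isAlternatingMultilinear det-cong additive det-⋖-rows
    where
    additive : ∀ u i x y → det R (u [ i ]≔ zipWith _+_ x y) ≈ det R (u [ i ]≔ x) + det R (u [ i ]≔ y)
    additive u i x y = det-additive-row i (λ _ r≢i → ≋-reflexive ([]≔-agrees u r≢i))
                                          (λ _ r≢i → ≋-reflexive ([]≔-agrees u r≢i)) ([]≔-zipWith u i x y)

  det-transpose-isAlternatingMultilinear : ∀ {N} → IsAlternatingMultilinear (det R {N} ∘ transpose)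
  det-transpose-isAlternatingMultilinear =
    FromAdjacent.isAlternatingMultilinear (λ u≋v → det-cong λ r x → u≋v x r) additive det-⋖-cols
    where
    additive : ∀ u i x y → det R (transpose (u [ i ]≔ zipWith _+_ x y)) ≈
                           det R (transpose (u [ i ]≔ x)) + det R (transpose (u [ i ]≔ y))
    additive u i x y = det-additive-col i (λ r _ k≢i → reflexive (cong-app ([]≔-agrees u k≢i) r))
                                          (λ r _ k≢i → reflexive (cong-app ([]≔-agrees u k≢i) r))
                                          ([]≔-zipWith u i x y)

  -- Moving the deleted block

  sgn-blockIndexSum-⋖ : ∀ {m} s {i j : Fin m} → i ⋖ j →
                        sgn R (blockIndexSum s j) ≈ sgn R s * sgn R (blockIndexSum s i)
  sgn-blockIndexSum-⋖ s i⋖j = ≈-trans (reflexive (cong (sgn R) (blockIndexSum-⋖ s i⋖j)))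
                                      (≈-trans (sgn-+ (s ℕ.* s) _) (*-congʳ (sgn-square s)))

  ⋖-invariant⇒constant : ∀ {n} (f : Fin (suc n) → Carrier) →
                         (∀ {i j} → i ⋖ j → f i ≈ f j) → ∀ i j → f i ≈ f j
  ⋖-invariant⇒constant f invariant i j = ≈-trans (≈zero f invariant i) (≈-sym (≈zero f invariant j))
    where
    ≈zero : ∀ {n} (f : Fin (suc n) → Carrier) → (∀ {i j} → i ⋖ j → f i ≈ f j) → ∀ i → f i ≈ f zero
    ≈zero f invariant zero    = ≈-refl
    ≈zero {suc n} f invariant (suc i) = ≈-trans (≈zero (f ∘ suc) (invariant ∘ s⋖s) i) (≈-sym (invariant 0⋖1))

  module BlockOmission {m s K} {F : Rows (m ℕ.* s) K → Carrier} (F-alt : IsAlternatingMultilinear F)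
    (v : Fin (suc m) → Fin s → Vector Carrier K) (Σv≈0 : ∀ q y → Σ R (λ t → v t q y) ≈ 0#) where

    open IsAlternatingMultilinear F-alt

    blocks : (Fin m → Fin s → Vector Carrier K) → Rows (m ℕ.* s) K
    blocks w r = w (quotient {m} s r) (remainder {m} s r)

    blocks-combine : ∀ w p q → blocks w (combine p q) ≡ w p q
    blocks-combine w p q = cong (uncurry w) (remQuot-combine p q)

    omitBlock : Fin (suc m) → Rows (m ℕ.* s) K
    omitBlock j = blocks (v ∘ punchIn j)

    -- In slot p★, interpolant n carries the first n rows of block a and the remaining rows of
    -- block b, so it runs from omitBlock a to omitBlock b as n goes from 0 to s. Each step
    -- exchanges a single row by zero-sum-exchange and costs a sign.
    module Interpolation {a b : Fin (suc m)} (a⋖b : a ⋖ b) where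

      a≢b : a ≢ b
      a≢b = ⋖⇒≢ a⋖b

      p★ : Fin m
      p★ = punchOut a≢b

      source : ℕ → Fin m → Fin s → Fin (suc m)
      source n p q = if does (toℕ q ℕ.<? n) then punchIn b p else punchIn a p

      interpolant : ℕ → Rows (m ℕ.* s) K
      interpolant n = blocks λ p q → v (source n p q) q

      interpolant-combine : ∀ n p q → interpolant n (combine p q) ≡ v (source n p q) q
      interpolant-combine n = blocks-combine λ p q → v (source n p q) q

      source-below : ∀ {n} p {q} → toℕ q ℕ.< n → source n p q ≡ punchIn b p
      source-below {n} p {q} q<n =
        cong (λ c → if c then punchIn b p else punchIn a p) (dec-true (toℕ q ℕ.<? n) q<n)

      source-above : ∀ {n} p {q} → ¬ toℕ q ℕ.< n → source n p q ≡ punchIn a p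
      source-above {n} p {q} q≮n =
        cong (λ c → if c then punchIn b p else punchIn a p) (dec-false (toℕ q ℕ.<? n) q≮n)

      source-unmoved : ∀ {n p q} → p ≢ p★ → source n p q ≡ punchIn a p
      source-unmoved {n} {p} {q} p≢p★ =
        trans (cong (if does (toℕ q ℕ.<? n) then_else _) (sym (⋖-punchIn-≡ a⋖b p (punchIn≢ a≢b p≢p★))))
              (if-eta _)

      interpolant-step : ∀ {n} → n ℕ.< s → F (interpolant (suc n)) ≈ - F (interpolant n)
      interpolant-step {n} n<s = begin
        F (interpolant (suc n))            ≈⟨ rows-cong-≗ after ⟩
        F (interpolant n [ c★ ]≔ v a q₀)
          ≈⟨ zero-sum-exchange (interpolant n) c★ (λ t → v t q₀) a≢b ∑v≈0 elsewhere ⟩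
        - F (interpolant n [ c★ ]≔ v b q₀) ≈⟨ -‿cong (rows-cong-≗ before) ⟨
        - F (interpolant n)                ∎
        where
        q₀ : Fin s
        q₀ = fromℕ< n<s
        c★ : Fin (m ℕ.* s)
        c★ = combine p★ q₀
        ∑v≈0 : ∀ y → ∑[ t < suc m ] v t q₀ y ≈ 0#
        ∑v≈0 y = ≈-trans (reflexive (sym (Σ≡sum λ t → v t q₀ y))) (Σv≈0 q₀ y)
        q₀≡n : toℕ q₀ ≡ n
        q₀≡n = toℕ-fromℕ< n<s
        q₀≮n : ¬ toℕ q₀ ℕ.< n
        q₀≮n q₀<n = ℕ.<-irrefl q₀≡n q₀<n
        agree : ∀ p q → ¬ (p ≡ p★ × q ≡ q₀) → source (suc n) p q ≡ source n p q
        agree p q ¬p★q₀ with q ≟ q₀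
        ... | yes refl = trans (source-unmoved {suc n} {q = q} p≢p★) (sym (source-unmoved {n} {q = q} p≢p★))
          where
          p≢p★ : p ≢ p★
          p≢p★ p≡p★ = ¬p★q₀ (p≡p★ , refl)
        ... | no q≢q₀  = cong (λ c → if c then punchIn b p else punchIn a p)
                              (does-⇔ (mk⇔ (λ q<1+n → ℕ.≤∧≢⇒< (ℕ.s≤s⁻¹ q<1+n) q≢n) ℕ.m<n⇒m<1+n)
                                      (toℕ q ℕ.<? suc n) (toℕ q ℕ.<? n))
          where
          q≢n : toℕ q ≢ n
          q≢n q≡n = q≢q₀ (toℕ-injective (trans q≡n (sym q₀≡n)))
        after : interpolant (suc n) ≗ interpolant n [ c★ ]≔ v a q₀
        after = ≗-[]≔ (trans (interpolant-combine (suc n) p★ q₀) (cong (λ t → v t q₀)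
                        (trans (source-below p★ (ℕ.≤-reflexive (cong suc q₀≡n)))
                               (⋖-punchIn-swap a⋖b p★ (punchIn-punchOut a≢b)))))
                      λ r r≢c★ → cong (λ t → v t (remainder {m} s r)) (agree _ _ λ (p≡p★ , q≡q₀) →
                        r≢c★ (trans (sym (combine-remQuot {m} s r)) (cong₂ combine p≡p★ q≡q₀)))
        before : interpolant n ≗ interpolant n [ c★ ]≔ v b q₀
        before = ≗-[]≔ (trans (interpolant-combine n p★ q₀) (cong (λ t → v t q₀)
                         (trans (source-above p★ q₀≮n) (punchIn-punchOut a≢b))))
                       λ _ _ → refl
        elsewhere : ∀ t → t ≢ a → t ≢ b → ∃[ r ] (r ≢ c★ × interpolant n r ≋ v t q₀)
        elsewhere t t≢a t≢b = combine p q₀ , (p≢p★ ∘ combine-injectiveˡ p q₀ p★ q₀) ,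
          ≋-reflexive (trans (interpolant-combine n p q₀)
                             (cong (λ t → v t q₀) (trans (source-above p q₀≮n) (punchIn-punchOut a≢t))))
          where
          a≢t : a ≢ t
          a≢t = t≢a ∘ sym
          p : Fin m
          p = punchOut a≢t
          p≢p★ : p ≢ p★
          p≢p★ p≡p★ = t≢b (trans (sym (punchIn-punchOut a≢t))
                                 (trans (cong (punchIn a) p≡p★) (punchIn-punchOut a≢b)))

      interpolant-zero : interpolant 0 ≗ omitBlock a
      interpolant-zero r = refl

      interpolant-full : interpolant s ≗ omitBlock b
      interpolant-full r =
        cong (λ t → v t (remainder {m} s r)) (source-below (quotient {m} s r) (toℕ<n (remainder {m} s r)))

      interpolant-iterate : ∀ n → n ℕ.≤ s → F (interpolant n) ≈ sgn R n * F (interpolant 0)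
      interpolant-iterate zero    _   = ≈-sym (*-identityˡ _)
      interpolant-iterate (suc n) n<s = ≈-trans (interpolant-step n<s)
        (≈-trans (-‿cong (interpolant-iterate n (ℕ.<⇒≤ n<s))) (-‿distribˡ-* _ _))

    omitBlock-⋖ : ∀ {a b} → a ⋖ b → F (omitBlock b) ≈ sgn R s * F (omitBlock a)
    omitBlock-⋖ {a} {b} a⋖b = begin
      F (omitBlock b)              ≈⟨ rows-cong-≗ interpolant-full ⟨
      F (interpolant s)            ≈⟨ interpolant-iterate s ℕ.≤-refl ⟩
      sgn R s * F (interpolant 0)  ≈⟨ *-congˡ (rows-cong-≗ interpolant-zero) ⟩
      sgn R s * F (omitBlock a)    ∎
      where open Interpolation a⋖b

    signedOmitBlock : Fin (suc m) → Carrier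
    signedOmitBlock j = sgn R (blockIndexSum s j) * F (omitBlock j)

    signedOmitBlock-constant : ∀ i j → signedOmitBlock i ≈ signedOmitBlock j
    signedOmitBlock-constant = ⋖-invariant⇒constant signedOmitBlock step
      where
      step : ∀ {a b} → a ⋖ b → signedOmitBlock a ≈ signedOmitBlock b
      step {a} {b} a⋖b = begin
        sgn R (blockIndexSum s a) * F (omitBlock a)                           ≈⟨ *-identityˡ _ ⟨
        1# * (sgn R (blockIndexSum s a) * F (omitBlock a))                    ≈⟨ *-congʳ (sgn*sgn≈1 s) ⟨
        (sgn R s * sgn R s) * (sgn R (blockIndexSum s a) * F (omitBlock a))   ≈⟨ interchange _ _ _ _ ⟩
        (sgn R s * sgn R (blockIndexSum s a)) * (sgn R s * F (omitBlock a))
          ≈⟨ *-cong (sgn-blockIndexSum-⋖ s a⋖b) (omitBlock-⋖ a⋖b) ⟨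
        sgn R (blockIndexSum s b) * F (omitBlock b)                           ∎

  module _ {m s} (A : Mat R (suc m ℕ.* s)) where

    blockCofactor-column-invariant :
      (∀ (i : Fin (suc m)) p q → Σ R (λ (j : Fin (suc m)) → A (combine {n = s} i p) (combine {n = s} j q)) ≈ 0#) →
                            ∀ i j l → blockCofactor R A i j ≈ blockCofactor R A i l
    blockCofactor-column-invariant rowSums≈0 i j l = begin
      blockCofactor R A i j                                                             ≈⟨ split j ⟩
      sgn R (blockIndexSum s i) * (sgn R (blockIndexSum s j) * det R (deleteBlocks R A i j))
        ≈⟨ *-congˡ (signedOmitBlock-constant j l) ⟩
      sgn R (blockIndexSum s i) * (sgn R (blockIndexSum s l) * det R (deleteBlocks R A i l)) ≈⟨ split l ⟨
      blockCofactor R A i l                                                             ∎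
      where
      open BlockOmission {m} {s} det-transpose-isAlternatingMultilinear
        (λ t q r → A (combine (punchIn i (quotient {m} s r)) (remainder {m} s r)) (combine t q))
        (λ q r → rowSums≈0 (punchIn i (quotient {m} s r)) (remainder {m} s r) q)
      split : ∀ j → blockCofactor R A i j ≈
                    sgn R (blockIndexSum s i) * (sgn R (blockIndexSum s j) * det R (deleteBlocks R A i j))
      split j = ≈-trans (*-congʳ (sgn-+ (blockIndexSum s i) (blockIndexSum s j))) (*-assoc _ _ _)

    blockCofactor-row-invariant :
      (∀ (j : Fin (suc m)) p q → Σ R (λ (i : Fin (suc m)) → A (combine {n = s} i p) (combine {n = s} j q)) ≈ 0#) →
                         ∀ i k l → blockCofactor R A i l ≈ blockCofactor R A k l
    blockCofactor-row-invariant colSums≈0 i k l = begin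
      blockCofactor R A i l                                                             ≈⟨ split i ⟩
      sgn R (blockIndexSum s l) * (sgn R (blockIndexSum s i) * det R (deleteBlocks R A i l))
        ≈⟨ *-congˡ (signedOmitBlock-constant i k) ⟩
      sgn R (blockIndexSum s l) * (sgn R (blockIndexSum s k) * det R (deleteBlocks R A k l)) ≈⟨ split k ⟨
      blockCofactor R A k l                                                             ∎
      where
      open BlockOmission {m} {s} det-isAlternatingMultilinear
        (λ t p x → A (combine t p) (combine (punchIn l (quotient {m} s x)) (remainder {m} s x)))
        (λ p x → colSums≈0 (punchIn l (quotient {m} s x)) p (remainder {m} s x))
      split : ∀ i → blockCofactor R A i l ≈
                    sgn R (blockIndexSum s l) * (sgn R (blockIndexSum s i) * det R (deleteBlocks R A i l))
      split i = ≈-trans (*-congʳ (≈-trans (sgn-+ (blockIndexSum s i) (blockIndexSum s l)) (*-comm _ _))) (*-assoc _ _ _)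

lemma2p2 : {c ℓ : Level} (R : CommutativeRing c ℓ) (m s : ℕ)
    (A : Mat R (suc m ℕ.* s)) →
    (∀ (i : Fin (suc m)) (p q : Fin s) →
    CommutativeRing._≈_ R (Σ R (λ (j : Fin (suc m)) → A (combine {n = s} i p) (combine {n = s} j q))) (CommutativeRing.0# R)) →
    (∀ (j : Fin (suc m)) (p q : Fin s) →
    CommutativeRing._≈_ R (Σ R (λ (i : Fin (suc m)) → A (combine {n = s} i p) (combine {n = s} j q))) (CommutativeRing.0# R)) →
    ∀ (i j k l : Fin (suc m)) →
    CommutativeRing._≈_ R (blockCofactor R A i j) (blockCofactor R A k l)
lemma2p2 R m s A rowSums≈0 colSums≈0 i j k l =
  CommutativeRing.trans R (blockCofactor-column-invariant R A rowSums≈0 i j l)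
                          (blockCofactor-row-invariant R A colSums≈0 i k l)
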